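{- For any permutation $w \in S_n$, $$|B(w)| + |C(w)| - 1 \le |R(w)| \le |B(w)|\cdot |C(w)|.$$
   Context: $S_n$ is generated by the adjacent transpositions $s_1,\dots,s_{n-1}$. A reduced word for $w$ is a sequence $i_1\cdots i_k$ with $w = s_{i_1}\cdots s_{i_k}$ and $k=\ell(w)$ minimal; $R(w)$ is the set of reduced words of $w$. A braid move replaces a factor (consecutive letters) $i(i+1)i$ by $(i+1)i(i+1)$ or vice versa; a commutation move replaces a factor $ij$ with $|i-j|>1$ by $ji$. $B(w)$ is the set of equivalence classes of $R(w)$ under sequences of braid moves (braid classes), and $C(w)$ is the set of equivalence classes of $R(w)$ under sequences of commutation moves (commutation classes). -}

module Defs where

open import Data.Nat using (ℕ; zero; suc; _+_; _*_; _≤_; _<_)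
open import Data.Nat.Properties using (_≟_)
open import Data.Fin using (Fin; toℕ)
open import Data.Fin.Permutation using (Permutation′; _⟨$⟩ʳ_)
open import Data.List using (List; []; _∷_; _++_; length)
open import Data.List.Relation.Unary.All using (All)
open import Data.List.Relation.Unary.Any using (Any)
open import Data.List.Relation.Unary.AllPairs using (AllPairs)
open import Data.List.Relation.Unary.Unique.Propositional using (Unique)
open import Data.List.Membership.Propositional using (_∈_)
open import Data.Product using (_×_)
open import Data.Sum using (_⊎_)
open import Relation.Nullary using (¬_; yes; no)
open import Relation.Binary.PropositionalEquality using (_≡_)
open import Relation.Binary.Construct.Closure.ReflexiveTransitive using (Star)

-- A word is a list of letters; letter i stands for the simple transposition s_i.
Word : Set
Word = List ℕ

ValidWord : ℕ → Word → Set
ValidWord n a = All (λ i → 1 ≤ i × suc i ≤ n) a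

-- s_i acting on positions {0, …, n-1} (0-based): swaps i-1 and i (i ≥ 1).
swapAt : ℕ → ℕ → ℕ
swapAt zero x = x
swapAt (suc j) x with x ≟ j | x ≟ suc j
... | yes _ | _     = suc j
... | no _  | yes _ = j
... | no _  | no _  = x

eval : Word → ℕ → ℕ
eval []      x = x
eval (i ∷ a) x = swapAt i (eval a x)

EvalsTo : {n : ℕ} → Word → Permutation′ n → Set
EvalsTo {n} a w = (x : Fin n) → toℕ (w ⟨$⟩ʳ x) ≡ eval a (toℕ x)

Reduced : {n : ℕ} → Permutation′ n → Word → Set
Reduced {n} w a =
  ValidWord n a × EvalsTo a w ×
  ((b : Word) → ValidWord n b → EvalsTo b w → length a ≤ length b)

data BraidStep : Word → Word → Set where
  braid-up   : (p q : Word) (i : ℕ) →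
    BraidStep (p ++ i ∷ suc i ∷ i ∷ q) (p ++ suc i ∷ i ∷ suc i ∷ q)
  braid-down : (p q : Word) (i : ℕ) →
    BraidStep (p ++ suc i ∷ i ∷ suc i ∷ q) (p ++ i ∷ suc i ∷ i ∷ q)

data CommStep : Word → Word → Set where
  comm : (p q : Word) (i j : ℕ) → (suc i < j ⊎ suc j < i) →
    CommStep (p ++ i ∷ j ∷ q) (p ++ j ∷ i ∷ q)

-- Equivalence generated by the moves (steps are closed under inversion).
BraidEquiv : Word → Word → Set
BraidEquiv = Star BraidStep

CommEquiv : Word → Word → Set
CommEquiv = Star CommStep

-- xs is a duplicate-free enumeration of the set {a | P a}; so |{a | P a}| = length xs.
IsEnumeration : (Word → Set) → List Word → Set
IsEnumeration P xs =
  Unique xs × ((a : Word) → a ∈ xs → P a) × ((a : Word) → P a → a ∈ xs)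

-- reps is a complete, irredundant system of representatives of the
-- ~-classes of {a | P a}; so the number of classes equals length reps.
IsClassReps : (Word → Word → Set) → (Word → Set) → List Word → Set
IsClassReps _~_ P reps =
  All P reps ×
  ((a : Word) → P a → Any (λ r → a ~ r) reps) ×
  AllPairs (λ r s → ¬ (r ~ s)) reps

-- Upper bound: for every letter of a word record the pair of values it transposes.  A commutation
-- move swaps two adjacent disjoint pairs and a braid move reverses three adjacent pairwise
-- overlapping ones, so commutation moves keep the relative order of any two overlapping pairs and
-- braid moves that of any two disjoint ones.  A word that is both braid and commutation equivalent
-- to another therefore has the same sequence of pairs, so it is the same word, and R(w) injects
-- into B(w) × C(w).
-- Lower bound: by Matsumoto's theorem R(w) is connected under both kinds of moves, so the graph on
-- B(w) ⊔ C(w) with an edge between the two classes of each reduced word is connected; a connected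
-- graph has at most one more vertex than it has edges.
module Submission where

open import Defs
open import Data.Nat using (ℕ; zero; suc; pred; _+_; _*_; _≤_; _<_; z≤n; s≤s; z<s; _<?_; _≤?_; _∸_)
open import Data.Nat.Properties
open import Data.Fin using (toℕ; fromℕ<)
open import Data.Fin.Properties using (toℕ-fromℕ<)
open import Data.Fin.Permutation using (Permutation′)
open import Data.Empty using (⊥-elim)
open import Data.Product using (_×_; _,_; proj₁; proj₂; ∃; ∃₂)
import Data.Product as Product
import Data.Product.Properties as Product
open import Data.Sum using (_⊎_; inj₁; inj₂)
import Data.Sum.Properties as Sum
open import Data.List using (List; []; _∷_; _++_; length; map; filter; applyUpTo; cartesianProduct)
open import Data.List.Properties
  using (filter-accept; filter-reject; filter-none; filter-++; length-++; length-++-sucʳ; length-map; ∷-injective; map-cong)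
import Data.List.Properties as List
open import Data.List.Membership.Propositional using (_∈_; find; mapWith∈)
open import Data.List.Membership.Propositional.Properties
  using (∈-∃++; ∈-++⁻; ∈-++⁺ˡ; ∈-++⁺ʳ; ∈-cartesianProduct⁺; ∈-map⁻)
open import Data.List.Membership.Setoid.Properties using (length-mapWith∈)
open import Data.List.Relation.Unary.Any using (here; there)
open import Data.List.Relation.Unary.All using (All; []; _∷_)
import Data.List.Relation.Unary.All as All
import Data.List.Relation.Unary.All.Properties as All
open import Data.List.Relation.Unary.AllPairs using (AllPairs; []; _∷_)
import Data.List.Relation.Unary.AllPairs as AllPairs
open import Data.List.Relation.Unary.Unique.Propositional using (Unique)
import Data.List.Relation.Unary.Unique.Propositional.Properties as Unique
open import Data.List.Relation.Binary.Permutation.Propositional using (↭-refl; ↭-swap)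
open import Data.List.Relation.Binary.Permutation.Propositional.Properties using (↭-length; filter-↭; ++⁺ˡ)
open import Relation.Nullary using (¬_; yes; no; Dec)
open import Relation.Nullary.Decidable using (_⊎-dec_)
open import Relation.Binary using (tri<; tri≈; tri>; DecidableEquality)
open import Relation.Binary.Construct.Closure.ReflexiveTransitive using (Star; ε; _◅_; _◅◅_; gmap; reverse)
open import Relation.Binary.PropositionalEquality
open import Function using (_∘_; case_of_)
open ≡-Reasoning

-- Simple transpositions

swapAt-left : ∀ j → swapAt (suc j) j ≡ suc j
swapAt-left j with j ≟ j
... | yes _  = refl
... | no j≢j = ⊥-elim (j≢j refl)

swapAt-right : ∀ j → swapAt (suc j) (suc j) ≡ j
swapAt-right j with suc j ≟ j | suc j ≟ suc j
... | yes 1+j≡j | _ = ⊥-elim (1+n≢n 1+j≡j)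
... | no _ | yes _  = refl
... | no _ | no ≢   = ⊥-elim (≢ refl)

swapAt-fixes : ∀ j x → x ≢ j → x ≢ suc j → swapAt (suc j) x ≡ x
swapAt-fixes j x x≢j x≢1+j with x ≟ j | x ≟ suc j
... | yes x≡j | _ = ⊥-elim (x≢j x≡j)
... | no _ | yes x≡1+j = ⊥-elim (x≢1+j x≡1+j)
... | no _ | no _ = refl

swapAt-below : ∀ j x → x < j → swapAt (suc j) x ≡ x
swapAt-below j x x<j = swapAt-fixes j x (<⇒≢ x<j) (<⇒≢ (m<n⇒m<1+n x<j))

swapAt-above : ∀ j x → suc j < x → swapAt (suc j) x ≡ x
swapAt-above j x 1+j<x = swapAt-fixes j x (>⇒≢ (<-trans (n<1+n _) 1+j<x)) (>⇒≢ 1+j<x)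

data SwapView (j x : ℕ) : Set where
  left  : x ≡ j → SwapView j x
  right : x ≡ suc j → SwapView j x
  other : x ≢ j → x ≢ suc j → SwapView j x

swapView : ∀ j x → SwapView j x
swapView j x with x ≟ j | x ≟ suc j
... | yes x≡j | _         = left x≡j
... | no _    | yes x≡1+j = right x≡1+j
... | no x≢j  | no x≢1+j  = other x≢j x≢1+j

swapAt-involutive : ∀ i x → swapAt i (swapAt i x) ≡ x
swapAt-involutive zero x = refl
swapAt-involutive (suc j) x with swapView j x
... | left refl  = trans (cong (swapAt (suc j)) (swapAt-left j)) (swapAt-right j)
... | right refl = trans (cong (swapAt (suc j)) (swapAt-right j)) (swapAt-left j)
... | other p q  = trans (cong (swapAt (suc j)) (swapAt-fixes j x p q)) (swapAt-fixes j x p q)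

swapAt-injective : ∀ i {x y} → swapAt i x ≡ swapAt i y → x ≡ y
swapAt-injective i {x} {y} eq = begin
  x                          ≡⟨ swapAt-involutive i x ⟨
  swapAt i (swapAt i x)      ≡⟨ cong (swapAt i) eq ⟩
  swapAt i (swapAt i y)      ≡⟨ swapAt-involutive i y ⟩
  y                          ∎

swapAt-commutes : ∀ {j} (f : ℕ → ℕ) → (∀ {x y} → f x ≡ f y → x ≡ y) →
  f j ≡ j → f (suc j) ≡ suc j → ∀ x → swapAt (suc j) (f x) ≡ f (swapAt (suc j) x)
swapAt-commutes {j} f f-inj fj fsj x with swapView j x
... | left refl  = trans (cong (swapAt (suc j)) fj) (trans (swapAt-left j) (sym (trans (cong f (swapAt-left j)) fsj)))
... | right refl = trans (cong (swapAt (suc j)) fsj) (trans (swapAt-right j) (sym (trans (cong f (swapAt-right j)) fj)))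
... | other p q  = trans (swapAt-fixes j (f x) (λ e → p (f-inj (trans e (sym fj)))) (λ e → q (f-inj (trans e (sym fsj)))))
                         (cong f (sym (swapAt-fixes j x p q)))

Far : ℕ → ℕ → Set
Far i j = suc i < j ⊎ suc j < i

swapAt-comm : ∀ {i j} → Far i j → ∀ x → swapAt i (swapAt j x) ≡ swapAt j (swapAt i x)
swapAt-comm {zero}  {j}     _ x = refl
swapAt-comm {suc a} {zero}  _ x = refl
swapAt-comm {suc a} {suc b} (inj₁ (s≤s a+1<b)) =
  swapAt-commutes (swapAt (suc b)) (swapAt-injective (suc b))
    (swapAt-below b a (<-trans (n<1+n a) a+1<b)) (swapAt-below b (suc a) a+1<b)
swapAt-comm {suc a} {suc b} (inj₂ (s≤s b+1<a)) x =
  sym (swapAt-commutes (swapAt (suc a)) (swapAt-injective (suc a))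
    (swapAt-below a b (<-trans (n<1+n b) b+1<a)) (swapAt-below a (suc b) b+1<a) x)

swapAt-braid : ∀ a x → let s = swapAt (suc a); t = swapAt (suc (suc a)) in s (t (s x)) ≡ t (s (t x))
swapAt-braid a x with swapView a x | swapView (suc a) x
... | left refl | _ = begin
  s (t (s a))  ≡⟨ cong (s ∘ t) (swapAt-left a) ⟩
  s (t (suc a)) ≡⟨ cong s (swapAt-left (suc a)) ⟩
  s (suc (suc a)) ≡⟨ swapAt-above a (suc (suc a)) ≤-refl ⟩
  suc (suc a)   ≡⟨ swapAt-left (suc a) ⟨
  t (suc a)     ≡⟨ cong t (swapAt-left a) ⟨
  t (s a)       ≡⟨ cong (t ∘ s) (swapAt-below (suc a) a (n<1+n a)) ⟨
  t (s (t a))   ∎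
  where s = swapAt (suc a); t = swapAt (suc (suc a))
... | right refl | _ = begin
  s (t (s (suc a))) ≡⟨ cong (s ∘ t) (swapAt-right a) ⟩
  s (t a)          ≡⟨ cong s (swapAt-below (suc a) a (n<1+n a)) ⟩
  s a              ≡⟨ swapAt-left a ⟩
  suc a            ≡⟨ swapAt-right (suc a) ⟨
  t (suc (suc a))  ≡⟨ cong t (swapAt-above a (suc (suc a)) ≤-refl) ⟨
  t (s (suc (suc a))) ≡⟨ cong (t ∘ s) (swapAt-left (suc a)) ⟨
  t (s (t (suc a))) ∎
  where s = swapAt (suc a); t = swapAt (suc (suc a))
... | other _ x≢1+a | left x≡1+a = ⊥-elim (x≢1+a x≡1+a)
... | other _ _ | right refl = begin
  s (t (s (suc (suc a)))) ≡⟨ cong (s ∘ t) (swapAt-above a (suc (suc a)) ≤-refl) ⟩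
  s (t (suc (suc a)))   ≡⟨ cong s (swapAt-right (suc a)) ⟩
  s (suc a)             ≡⟨ swapAt-right a ⟩
  a                     ≡⟨ swapAt-below (suc a) a (n<1+n a) ⟨
  t a                   ≡⟨ cong t (swapAt-right a) ⟨
  t (s (suc a))         ≡⟨ cong (t ∘ s) (swapAt-right (suc a)) ⟨
  t (s (t (suc (suc a)))) ∎
  where s = swapAt (suc a); t = swapAt (suc (suc a))
... | other p q | other p′ q′ = begin
  s (t (s x)) ≡⟨ cong (s ∘ t) (swapAt-fixes a x p q) ⟩
  s (t x)     ≡⟨ cong s (swapAt-fixes (suc a) x p′ q′) ⟩
  s x         ≡⟨ swapAt-fixes a x p q ⟩
  x           ≡⟨ swapAt-fixes (suc a) x p′ q′ ⟨
  t x         ≡⟨ cong t (swapAt-fixes a x p q) ⟨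
  t (s x)     ≡⟨ cong (t ∘ s) (swapAt-fixes (suc a) x p′ q′) ⟨
  t (s (t x)) ∎
  where s = swapAt (suc a); t = swapAt (suc (suc a))

swapAt-< : ∀ {i n x} → i < n → x < n → swapAt i x < n
swapAt-< {zero}  _ x<n = x<n
swapAt-< {suc j} {n} {x} j+1<n x<n with swapView j x
... | left refl  = subst (_< n) (sym (swapAt-left j)) j+1<n
... | right refl = subst (_< n) (sym (swapAt-right j)) (<-trans (n<1+n j) x<n)
... | other p q  = subst (_< n) (sym (swapAt-fixes j x p q)) x<n

swapAt-≥ : ∀ {i n x} → i < n → n ≤ x → swapAt i x ≡ x
swapAt-≥ {zero}  _ _ = refl
swapAt-≥ {suc j} {x = x} j+1<n n≤x = swapAt-above j x (<-≤-trans j+1<n n≤x)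

swapAt-suc : ∀ j x → swapAt (suc (suc j)) (suc x) ≡ suc (swapAt (suc j) x)
swapAt-suc j x with swapView j x
... | left refl  = trans (swapAt-left (suc j)) (cong suc (sym (swapAt-left j)))
... | right refl = trans (swapAt-right (suc j)) (cong suc (sym (swapAt-right j)))
... | other p q  = trans (swapAt-fixes (suc j) (suc x) (p ∘ suc-injective) (q ∘ suc-injective))
                         (cong suc (sym (swapAt-fixes j x p q)))

-- Words as permutations

-- The inverse of eval a.  Prepending a letter to a swaps two adjacent positions of the one-line
-- notation of evalInv a, which is what makes the inversion number below track length.
evalInv : Word → ℕ → ℕ
evalInv []      x = x
evalInv (i ∷ a) x = evalInv a (swapAt i x)

eval-evalInv : ∀ a x → eval a (evalInv a x) ≡ x
eval-evalInv []      x = refl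
eval-evalInv (i ∷ a) x = trans (cong (swapAt i) (eval-evalInv a (swapAt i x))) (swapAt-involutive i x)

evalInv-eval : ∀ a x → evalInv a (eval a x) ≡ x
evalInv-eval []      x = refl
evalInv-eval (i ∷ a) x = trans (cong (evalInv a) (swapAt-involutive i (eval a x))) (evalInv-eval a x)

evalInv-injective : ∀ a {x y} → evalInv a x ≡ evalInv a y → x ≡ y
evalInv-injective a {x} {y} eq = begin
  x                    ≡⟨ eval-evalInv a x ⟨
  eval a (evalInv a x) ≡⟨ cong (eval a) eq ⟩
  eval a (evalInv a y) ≡⟨ eval-evalInv a y ⟩
  y                    ∎

evalInv-++ : ∀ p q x → evalInv (p ++ q) x ≡ evalInv q (evalInv p x)
evalInv-++ []      q x = refl
evalInv-++ (i ∷ p) q x = evalInv-++ p q (swapAt i x)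

infix 4 _≃_

record _≃_ (a b : Word) : Set where
  constructor mk≃
  field evalInv-≗ : evalInv a ≗ evalInv b
open _≃_ public

≃-sym : ∀ {a b} → a ≃ b → b ≃ a
≃-sym (mk≃ e) = mk≃ (sym ∘ e)

≃-trans : ∀ {a b c} → a ≃ b → b ≃ c → a ≃ c
≃-trans (mk≃ e) (mk≃ e′) = mk≃ λ x → trans (e x) (e′ x)

∷-≃ : ∀ i {a b} → a ≃ b → i ∷ a ≃ i ∷ b
∷-≃ i (mk≃ e) = mk≃ (e ∘ swapAt i)

++-≃ : ∀ p {a b} → a ≃ b → p ++ a ≃ p ++ b
++-≃ p {a} {b} (mk≃ e) = mk≃ λ x → trans (evalInv-++ p a x) (trans (e (evalInv p x)) (sym (evalInv-++ p b x)))

∷-≃-evalInv : ∀ {i a b} → i ∷ a ≃ b → ∀ x → evalInv a x ≡ evalInv b (swapAt i x)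
∷-≃-evalInv {i} {a} (mk≃ e) x = trans (cong (evalInv a) (sym (swapAt-involutive i x))) (e (swapAt i x))

∷-cancel-≃ : ∀ i {a b} → i ∷ a ≃ i ∷ b → a ≃ b
∷-cancel-≃ i {b = b} ia≃ib = mk≃ λ x → trans (∷-≃-evalInv ia≃ib x) (cong (evalInv b) (swapAt-involutive i x))

∷-≃-flip : ∀ i {a b} → a ≃ i ∷ b → i ∷ a ≃ b
∷-≃-flip i {b = b} (mk≃ e) = mk≃ λ x → trans (e (swapAt i x)) (cong (evalInv b) (swapAt-involutive i x))

eval⇒≃ : ∀ a b → eval a ≗ eval b → a ≃ b
eval⇒≃ a b eq = mk≃ λ x → begin
  evalInv a x                     ≡⟨ evalInv-eval b (evalInv a x) ⟨
  evalInv b (eval b (evalInv a x)) ≡⟨ cong (evalInv b) (eq (evalInv a x)) ⟨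
  evalInv b (eval a (evalInv a x)) ≡⟨ cong (evalInv b) (eval-evalInv a x) ⟩
  evalInv b x                     ∎

≃⇒eval : ∀ a b → a ≃ b → eval a ≗ eval b
≃⇒eval a b (mk≃ a≃b) x = begin
  eval a x                         ≡⟨ cong (eval a) (evalInv-eval b x) ⟨
  eval a (evalInv b (eval b x))    ≡⟨ cong (eval a) (a≃b (eval b x)) ⟨
  eval a (evalInv a (eval b x))    ≡⟨ eval-evalInv a (eval b x) ⟩
  eval b x                         ∎

module _ {n : ℕ} where

  eval-≥ : ∀ {a x} → ValidWord n a → n ≤ x → eval a x ≡ x
  eval-≥ []                      n≤x = refl
  eval-≥ {i ∷ a} ((_ , i<n) ∷ v) n≤x = trans (cong (swapAt i) (eval-≥ v n≤x)) (swapAt-≥ i<n n≤x)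

  evalInv-≥ : ∀ {a x} → ValidWord n a → n ≤ x → evalInv a x ≡ x
  evalInv-≥ []                      n≤x = refl
  evalInv-≥ {i ∷ a} ((_ , i<n) ∷ v) n≤x = trans (cong (evalInv a) (swapAt-≥ i<n n≤x)) (evalInv-≥ v n≤x)

  evalInv-< : ∀ {a x} → ValidWord n a → x < n → evalInv a x < n
  evalInv-< []              x<n = x<n
  evalInv-< ((_ , i<n) ∷ v) x<n = evalInv-< v (swapAt-< i<n x<n)

-- Inversion number

count-< : ℕ → List ℕ → ℕ
count-< z xs = length (filter (_<? z) xs)

inversions : List ℕ → ℕ
inversions []       = 0
inversions (x ∷ xs) = count-< x xs + inversions xs

count-<-swap : ∀ z P {x y} Q → count-< z (P ++ x ∷ y ∷ Q) ≡ count-< z (P ++ y ∷ x ∷ Q)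
count-<-swap z P {x} {y} Q = ↭-length (filter-↭ (_<? z) (++⁺ˡ P (↭-swap x y ↭-refl)))

inversions-swap : ∀ P {x y} Q → x < y → inversions (P ++ y ∷ x ∷ Q) ≡ suc (inversions (P ++ x ∷ y ∷ Q))
inversions-swap (z ∷ P) Q x<y = begin
  count-< z (P ++ _ ∷ _ ∷ Q) + inversions (P ++ _ ∷ _ ∷ Q)
    ≡⟨ cong₂ _+_ (count-<-swap z P Q) (inversions-swap P Q x<y) ⟩
  count-< z (P ++ _ ∷ _ ∷ Q) + suc (inversions (P ++ _ ∷ _ ∷ Q))
    ≡⟨ +-suc _ _ ⟩
  suc (count-< z (P ++ _ ∷ _ ∷ Q) + inversions (P ++ _ ∷ _ ∷ Q)) ∎
inversions-swap [] {x} {y} Q x<y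
  rewrite filter-accept (_<? y) {xs = Q} x<y | filter-reject (_<? x) {xs = Q} (<⇒≯ x<y)
  = cong suc (begin
    count-< y Q + (count-< x Q + inversions Q) ≡⟨ +-assoc (count-< y Q) _ _ ⟨
    count-< y Q + count-< x Q + inversions Q   ≡⟨ cong (_+ inversions Q) (+-comm (count-< y Q) _) ⟩
    count-< x Q + count-< y Q + inversions Q   ≡⟨ +-assoc (count-< x Q) _ _ ⟩
    count-< x Q + (count-< y Q + inversions Q) ∎)

inversions-monotone : ∀ (f : ℕ → ℕ) k → (∀ {x y} → x ≤ y → f x ≤ f y) → inversions (applyUpTo f k) ≡ 0
inversions-monotone f zero    mono = refl
inversions-monotone f (suc k) mono = cong₂ _+_
  (cong length (filter-none (_<? f 0) (All.applyUpTo⁺₂ (f ∘ suc) k (λ _ → ≤⇒≯ (mono z≤n)))))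
  (inversions-monotone (f ∘ suc) k (mono ∘ s≤s))

applyUpTo-cong : ∀ {f g : ℕ → ℕ} → f ≗ g → ∀ k → applyUpTo f k ≡ applyUpTo g k
applyUpTo-cong f≗g zero    = refl
applyUpTo-cong f≗g (suc k) = cong₂ _∷_ (f≗g 0) (applyUpTo-cong (f≗g ∘ suc) k)

applyUpTo-swapAt : ∀ (g : ℕ → ℕ) {j k} → suc j < k → ∃₂ λ P Q →
  applyUpTo g k ≡ P ++ g j ∷ g (suc j) ∷ Q ×
  applyUpTo (g ∘ swapAt (suc j)) k ≡ P ++ g (suc j) ∷ g j ∷ Q
applyUpTo-swapAt g {zero} {suc zero} (s≤s ())
applyUpTo-swapAt g {zero} {suc (suc k)} _ = [] , applyUpTo (g ∘ suc ∘ suc) k , refl ,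
  cong₂ _∷_ (cong g (swapAt-left 0)) (cong₂ _∷_ (cong g (swapAt-right 0))
    (applyUpTo-cong (λ x → cong g (swapAt-above 0 (suc (suc x)) (s≤s (s≤s z≤n)))) k))
applyUpTo-swapAt g {suc j} {suc k} (s≤s j+1<k) with applyUpTo-swapAt (g ∘ suc) j+1<k
... | P , Q , g≡ , g∘swap≡ = g 0 ∷ P , Q , cong (g 0 ∷_) g≡ ,
  cong₂ _∷_ (cong g (swapAt-below (suc j) 0 z<s))
    (trans (applyUpTo-cong (λ x → cong g (swapAt-suc j x)) k) g∘swap≡)

inversions-swapAt : ∀ (g : ℕ → ℕ) {j k} → suc j < k → g j < g (suc j) →
  inversions (applyUpTo (g ∘ swapAt (suc j)) k) ≡ suc (inversions (applyUpTo g k))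
inversions-swapAt g j+1<k asc with applyUpTo-swapAt g j+1<k
... | P , Q , g≡ , g∘swap≡ rewrite g≡ | g∘swap≡ = inversions-swap P Q asc

module _ {n : ℕ} (g : ℕ → ℕ) (increasing : ∀ j → suc j < n → g j < g (suc j)) where

  increasing-≥ : ∀ x → x < n → x ≤ g x
  increasing-≥ zero    _   = z≤n
  increasing-≥ (suc x) x<n = ≤-<-trans (increasing-≥ x (<-trans (n<1+n x) x<n)) (increasing x x<n)

  increasing-+ : ∀ x k → x + k < n → g x + k ≤ g (x + k)
  increasing-+ x zero    _ rewrite +-identityʳ x | +-identityʳ (g x) = ≤-refl
  increasing-+ x (suc k) x+k+1<n rewrite +-suc x k | +-suc (g x) k =
    ≤-<-trans (increasing-+ x k (<-trans (n<1+n _) x+k+1<n)) (increasing (x + k) x+k+1<n)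

  increasing⇒id : (∀ x → x < n → g x < n) → ∀ x → x < n → g x ≡ x
  increasing⇒id g< x x<n = ≤-antisym (+-cancelʳ-≤ r (g x) x (<⇒≤pred g[x+r]<x+1+r)) (increasing-≥ x x<n)
    where
    r = n ∸ suc x
    x+1+r≡n : suc x + r ≡ n
    x+1+r≡n = m+[n∸m]≡n x<n
    x+r<n : x + r < n
    x+r<n = subst (x + r <_) x+1+r≡n (n<1+n (x + r))
    g[x+r]<x+1+r : g x + r < suc x + r
    g[x+r]<x+1+r = ≤-<-trans (increasing-+ x r x+r<n) (subst (g (x + r) <_) (sym x+1+r≡n) (g< (x + r) x+r<n))

descent-or-sorted : ∀ (g : ℕ → ℕ) k →
  (∃ λ j → suc j < k × g (suc j) < g j) ⊎ (∀ j → suc j < k → g j ≤ g (suc j))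
descent-or-sorted g zero    = inj₂ λ _ ()
descent-or-sorted g (suc zero) = inj₂ λ { _ (s≤s ()) }
descent-or-sorted g (suc (suc k)) with descent-or-sorted g (suc k) | g k ≤? g (suc k)
... | inj₁ (j , j+1<k+1 , desc) | _ = inj₁ (j , m<n⇒m<1+n j+1<k+1 , desc)
... | inj₂ _      | no g[k]≰ = inj₁ (k , ≤-refl , ≰⇒> g[k]≰)
... | inj₂ sorted | yes g[k]≤ = inj₂ λ j j+1<k+2 → case m<1+n⇒m<n∨m≡n j+1<k+2 of λ where
  (inj₁ j+1<k+1) → sorted j j+1<k+1
  (inj₂ refl)    → g[k]≤

-- Coxeter length

module Length (n : ℕ) where

  ℓ : Word → ℕ
  ℓ a = inversions (applyUpTo (evalInv a) n)

  ℓ-[] : ℓ [] ≡ 0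
  ℓ-[] = inversions-monotone (λ x → x) n (λ x≤y → x≤y)

  ℓ-≃ : ∀ {a b} → a ≃ b → ℓ a ≡ ℓ b
  ℓ-≃ (mk≃ e) = cong inversions (applyUpTo-cong e n)

  Descent : Word → ℕ → Set
  Descent a j = evalInv a (suc j) < evalInv a j

  ascent-or-descent : ∀ a j → evalInv a j < evalInv a (suc j) ⊎ Descent a j
  ascent-or-descent a j with <-cmp (evalInv a j) (evalInv a (suc j))
  ... | tri< asc _ _  = inj₁ asc
  ... | tri≈ _ eq _   = ⊥-elim (1+n≢n (sym (evalInv-injective a eq)))
  ... | tri> _ _ desc = inj₂ desc

  ℓ-ascent : ∀ a {j} → suc j < n → evalInv a j < evalInv a (suc j) → ℓ (suc j ∷ a) ≡ suc (ℓ a)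
  ℓ-ascent a j+1<n asc = inversions-swapAt (evalInv a) j+1<n asc

  ℓ-descent : ∀ a {j} → suc j < n → Descent a j → suc (ℓ (suc j ∷ a)) ≡ ℓ a
  ℓ-descent a {j} j+1<n desc = begin
    suc (ℓ (suc j ∷ a))     ≡⟨ ℓ-ascent (suc j ∷ a) j+1<n ascent ⟨
    ℓ (suc j ∷ suc j ∷ a)   ≡⟨ ℓ-≃ {suc j ∷ suc j ∷ a} {a} (mk≃ (cong (evalInv a) ∘ swapAt-involutive (suc j))) ⟩
    ℓ a                     ∎
    where
    ascent : evalInv (suc j ∷ a) j < evalInv (suc j ∷ a) (suc j)
    ascent = subst₂ _<_ (cong (evalInv a) (sym (swapAt-left j))) (cong (evalInv a) (sym (swapAt-right j))) desc

  ℓ-≤-length : ∀ {a} → ValidWord n a → ℓ a ≤ length a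
  ℓ-≤-length [] = ≤-reflexive ℓ-[]
  ℓ-≤-length {zero ∷ a}  ((() , _) ∷ _)
  ℓ-≤-length {suc j ∷ a} ((_ , j+1<n) ∷ v) with ascent-or-descent a j
  ... | inj₁ asc  = ≤-trans (≤-reflexive (ℓ-ascent a j+1<n asc)) (s≤s (ℓ-≤-length v))
  ... | inj₂ desc = ≤-trans (n≤1+n _)
    (≤-trans (≤-reflexive (ℓ-descent a j+1<n desc)) (m≤n⇒m≤1+n (ℓ-≤-length v)))

  sorted⇒≃[] : ∀ {a} → ValidWord n a → (∀ j → suc j < n → evalInv a j ≤ evalInv a (suc j)) → [] ≃ a
  sorted⇒≃[] {a} v sorted = mk≃ fixes
    where
    increasing : ∀ j → suc j < n → evalInv a j < evalInv a (suc j)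
    increasing j j+1<n = ≤∧≢⇒< (sorted j j+1<n) (λ eq → 1+n≢n (sym (evalInv-injective a eq)))
    fixes : ∀ x → x ≡ evalInv a x
    fixes x with x <? n
    ... | yes x<n = sym (increasing⇒id (evalInv a) increasing (λ _ → evalInv-< v) x x<n)
    ... | no x≮n  = sym (evalInv-≥ v (≮⇒≥ x≮n))

  wordOfLength-ℓ : ∀ {a} → ValidWord n a → ∃ λ d → ValidWord n d × length d ≡ ℓ a × d ≃ a
  wordOfLength-ℓ {a} v = go (ℓ a) v refl
    where
    go : ∀ k {a} → ValidWord n a → ℓ a ≡ k → ∃ λ d → ValidWord n d × length d ≡ ℓ a × d ≃ a
    go k {a} v ℓa≡k with descent-or-sorted (evalInv a) n
    ... | inj₂ sorted = [] , [] , trans (sym ℓ-[]) (ℓ-≃ (sorted⇒≃[] v sorted)) , sorted⇒≃[] v sorted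
    go zero    {a} v ℓa≡0 | inj₁ (j , j+1<n , desc) = ⊥-elim (1+n≢0 (trans (ℓ-descent a j+1<n desc) ℓa≡0))
    go (suc k) {a} v ℓa≡k | inj₁ (j , j+1<n , desc)
      with go k ((s≤s z≤n , j+1<n) ∷ v) (suc-injective (trans (ℓ-descent a j+1<n desc) ℓa≡k))
    ... | d , vd , d-length , d≃ =
      suc j ∷ d , (s≤s z≤n , j+1<n) ∷ vd , trans (cong suc d-length) (ℓ-descent a j+1<n desc) , ∷-≃-flip (suc j) d≃

  Minimal : Word → Set
  Minimal a = ValidWord n a × ℓ a ≡ length a

  module _ {w : Permutation′ n} where

    Reduced⇒Minimal : ∀ {a} → Reduced w a → Minimal a
    Reduced⇒Minimal {a} (v , a↦w , shortest) with wordOfLength-ℓ v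
    ... | d , vd , d-length , d≃a = v , ≤-antisym (ℓ-≤-length v)
      (≤-trans (shortest d vd (λ x → trans (a↦w x) (≃⇒eval a d (≃-sym d≃a) (toℕ x)))) (≤-reflexive d-length))

    Reduced⇒≃ : ∀ {a b} → Reduced w a → Reduced w b → a ≃ b
    Reduced⇒≃ {a} {b} (va , a↦w , _) (vb , b↦w , _) = eval⇒≃ a b agree
      where
      agree : eval a ≗ eval b
      agree x with x <? n
      ... | yes x<n = subst (λ y → eval a y ≡ eval b y) (toℕ-fromℕ< x<n)
                        (trans (sym (a↦w (fromℕ< x<n))) (b↦w (fromℕ< x<n)))
      ... | no x≮n = trans (eval-≥ va (≮⇒≥ x≮n)) (sym (eval-≥ vb (≮⇒≥ x≮n)))

-- Braid and commutation moves

Move : Word → Word → Set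
Move u v = BraidStep u v ⊎ CommStep u v

BraidStep-sym : ∀ {u v} → BraidStep u v → BraidStep v u
BraidStep-sym (braid-up p q i)   = braid-down p q i
BraidStep-sym (braid-down p q i) = braid-up p q i

Far-sym : ∀ {i j} → Far i j → Far j i
Far-sym (inj₁ far) = inj₂ far
Far-sym (inj₂ far) = inj₁ far

CommStep-sym : ∀ {u v} → CommStep u v → CommStep v u
CommStep-sym (comm p q i j far) = comm p q j i (Far-sym far)

Move-sym : ∀ {u v} → Move u v → Move v u
Move-sym (inj₁ b) = inj₁ (BraidStep-sym b)
Move-sym (inj₂ c) = inj₂ (CommStep-sym c)

BraidEquiv-sym : ∀ {u v} → BraidEquiv u v → BraidEquiv v u
BraidEquiv-sym = reverse BraidStep-sym

CommEquiv-sym : ∀ {u v} → CommEquiv u v → CommEquiv v u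
CommEquiv-sym = reverse CommStep-sym

Move-∷ : ∀ i {u v} → Move u v → Move (i ∷ u) (i ∷ v)
Move-∷ i (inj₁ (braid-up p q k))   = inj₁ (braid-up (i ∷ p) q k)
Move-∷ i (inj₁ (braid-down p q k)) = inj₁ (braid-down (i ∷ p) q k)
Move-∷ i (inj₂ (comm p q k l far)) = inj₂ (comm (i ∷ p) q k l far)

Moves-∷ : ∀ i {u v} → Star Move u v → Star Move (i ∷ u) (i ∷ v)
Moves-∷ i = gmap (i ∷_) (Move-∷ i)

Move-length : ∀ {u v} → Move u v → length u ≡ length v
Move-length (inj₁ (braid-up p q _))   = trans (length-++ p) (sym (length-++ p))
Move-length (inj₁ (braid-down p q _)) = trans (length-++ p) (sym (length-++ p))
Move-length (inj₂ (comm p q _ _ _))   = trans (length-++ p) (sym (length-++ p))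

braid-≃ : ∀ a q → suc a ∷ suc (suc a) ∷ suc a ∷ q ≃ suc (suc a) ∷ suc a ∷ suc (suc a) ∷ q
braid-≃ a q = mk≃ (cong (evalInv q) ∘ swapAt-braid a)

comm-≃ : ∀ {i j} q → Far i j → i ∷ j ∷ q ≃ j ∷ i ∷ q
comm-≃ q far = mk≃ λ x → cong (evalInv q) (sym (swapAt-comm far x))

module _ {n : ℕ} where

  Move-valid : ∀ {u v} → ValidWord n u → Move u v → ValidWord n v
  Move-valid v (inj₁ (braid-up p q _)) with All.++⁻ p v
  ... | vp , vi ∷ vi+1 ∷ vi′ ∷ vq = All.++⁺ vp (vi+1 ∷ vi ∷ vi+1 ∷ vq)
  Move-valid v (inj₁ (braid-down p q _)) with All.++⁻ p v
  ... | vp , vi+1 ∷ vi ∷ vi+1′ ∷ vq = All.++⁺ vp (vi ∷ vi+1 ∷ vi ∷ vq)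
  Move-valid v (inj₂ (comm p q _ _ _)) with All.++⁻ p v
  ... | vp , vi ∷ vj ∷ vq = All.++⁺ vp (vj ∷ vi ∷ vq)

  -- Letter 0 acts as the identity, so a braid move involving it changes the permutation.
  Move-≃ : ∀ {u v} → ValidWord n u → Move u v → u ≃ v
  Move-≃ v (inj₁ (braid-up p q i)) with All.++⁻ p v
  Move-≃ v (inj₁ (braid-up p q zero))    | _ , (() , _) ∷ _
  Move-≃ v (inj₁ (braid-up p q (suc a))) | _ = ++-≃ p (braid-≃ a q)
  Move-≃ v (inj₁ (braid-down p q i)) with All.++⁻ p v
  Move-≃ v (inj₁ (braid-down p q zero))    | _ , _ ∷ (() , _) ∷ _
  Move-≃ v (inj₁ (braid-down p q (suc a))) | _ = ++-≃ p (≃-sym (braid-≃ a q))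
  Move-≃ v (inj₂ (comm p q _ _ far)) = ++-≃ p (comm-≃ q far)

  Move-Reduced : ∀ {w : Permutation′ n} {u v} → Reduced w u → Move u v → Reduced w v
  Move-Reduced {u = u} {v} (vu , u↦w , shortest) move =
    Move-valid vu move ,
    (λ x → trans (u↦w x) (≃⇒eval u v (Move-≃ vu move) _)) ,
    (λ b vb b↦w → subst (_≤ length b) (Move-length move) (shortest b vb b↦w))

-- Matsumoto's theorem

module Matsumoto (n : ℕ) where
  open Length n

  Minimal-∷⁻ : ∀ {j a} → Minimal (suc j ∷ a) → Minimal a × Descent (suc j ∷ a) j
  Minimal-∷⁻ {j} {a} ((_ , j+1<n) ∷ va , ℓ≡) with ascent-or-descent a j
  ... | inj₁ asc  = (va , suc-injective (trans (sym (ℓ-ascent a j+1<n asc)) ℓ≡)) ,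
                    subst₂ _<_ (cong (evalInv a) (sym (swapAt-right j))) (cong (evalInv a) (sym (swapAt-left j))) asc
  ... | inj₂ desc = ⊥-elim (1+n≰n (≤-trans (n≤1+n _) (≤-trans
    (≤-reflexive (trans (cong suc (sym ℓ≡)) (ℓ-descent a j+1<n desc))) (ℓ-≤-length va))))

  Minimal-head : ∀ {i a} → Minimal (i ∷ a) → i < n
  Minimal-head ((_ , i<n) ∷ _ , _) = i<n

  Minimal-tail : ∀ {i a} → Minimal (i ∷ a) → Minimal a
  Minimal-tail {zero}  ((() , _) ∷ _ , _)
  Minimal-tail {suc j} m = proj₁ (Minimal-∷⁻ m)

  Minimal-≃-length : ∀ {a b} → Minimal a → Minimal b → a ≃ b → length a ≡ length b
  Minimal-≃-length (_ , ℓa≡) (_ , ℓb≡) a≃b = trans (sym ℓa≡) (trans (ℓ-≃ a≃b) ℓb≡)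

  Minimal-∷-≃ : ∀ {i a b} → Minimal (i ∷ a) → Minimal b → b ≃ a → Minimal (i ∷ b)
  Minimal-∷-≃ {i} {a} {b} ma@(vi ∷ _ , ℓ≡) mb b≃a = vi ∷ proj₁ mb , (begin
    ℓ (i ∷ b)        ≡⟨ ℓ-≃ {i ∷ b} {i ∷ a} (∷-≃ i b≃a) ⟩
    ℓ (i ∷ a)        ≡⟨ ℓ≡ ⟩
    suc (length a)   ≡⟨ cong suc (Minimal-≃-length mb (Minimal-tail ma) b≃a) ⟨
    suc (length b)   ∎)

  Move-Minimal : ∀ {u v} → Minimal u → Move u v → Minimal v
  Move-Minimal {u} {v} (vu , ℓ≡) move =
    Move-valid vu move , trans (ℓ-≃ {v} {u} (≃-sym (Move-≃ vu move))) (trans ℓ≡ (Move-length move))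

  descent-prefix : ∀ {a j} → ValidWord n a → suc j < n → Descent a j →
    ∃ λ d → Minimal (suc j ∷ d) × suc j ∷ d ≃ a
  descent-prefix {a} {j} va j+1<n desc with wordOfLength-ℓ {suc j ∷ a} ((s≤s z≤n , j+1<n) ∷ va)
  ... | d , vd , d-length , d≃ = d , ((s≤s z≤n , j+1<n) ∷ vd , (begin
    ℓ (suc j ∷ d)           ≡⟨ ℓ-≃ {suc j ∷ d} {a} jd≃a ⟩
    ℓ a                     ≡⟨ ℓ-descent a j+1<n desc ⟨
    suc (ℓ (suc j ∷ a))     ≡⟨ cong suc d-length ⟨
    suc (length d)          ∎)) , jd≃a
    where
    jd≃a : suc j ∷ d ≃ a
    jd≃a = ∷-≃-flip (suc j) d≃

  Descent-≃ : ∀ {a b j} → a ≃ b → Descent b j → Descent a j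
  Descent-≃ a≃b = subst₂ _<_ (sym (evalInv-≗ a≃b _)) (sym (evalInv-≗ a≃b _))

  comm-prefix : ∀ {a js jt} → ValidWord n a → suc js < jt → suc jt < n → Descent a js → Descent a jt →
    ∃ λ d → Minimal (suc js ∷ suc jt ∷ d) × suc js ∷ suc jt ∷ d ≃ a
  comm-prefix {a} {js} {jt} va far jt+1<n desc-s desc-t =
    let d₁ , m₁ , e₁ = descent-prefix va (<-trans (m<n⇒m<1+n far) jt+1<n) desc-s
        d  , m₂ , e₂ = descent-prefix (proj₁ (Minimal-tail m₁)) jt+1<n (desc-d₁ e₁)
    in d , Minimal-∷-≃ m₁ m₂ e₂ , ≃-trans (∷-≃ (suc js) e₂) e₁
    where
    desc-d₁ : ∀ {d₁} → suc js ∷ d₁ ≃ a → Descent d₁ jt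
    desc-d₁ e₁ = subst₂ _<_
      (sym (trans (∷-≃-evalInv e₁ _) (cong (evalInv a) (swapAt-above js (suc jt) (m<n⇒m<1+n far)))))
      (sym (trans (∷-≃-evalInv e₁ _) (cong (evalInv a) (swapAt-above js jt far))))
      desc-t

  braid-prefix : ∀ {a j} → ValidWord n a → suc (suc j) < n → Descent a j → Descent a (suc j) →
    ∃ λ d → Minimal (suc j ∷ suc (suc j) ∷ suc j ∷ d) × suc j ∷ suc (suc j) ∷ suc j ∷ d ≃ a
  braid-prefix {a} {j} va j+2<n desc-s desc-t =
    let d₁ , m₁ , e₁ = descent-prefix va (<-trans (n<1+n _) j+2<n) desc-s
        d₂ , m₂ , e₂ = descent-prefix (proj₁ (Minimal-tail m₁)) j+2<n (desc-d₁ e₁)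
        d  , m₃ , e₃ = descent-prefix (proj₁ (Minimal-tail m₂)) (<-trans (n<1+n _) j+2<n) (desc-d₂ e₁ e₂)
        tsd≃d₁ = ≃-trans (∷-≃ t e₃) e₂
    in d , Minimal-∷-≃ m₁ (Minimal-∷-≃ m₂ m₃ e₃) tsd≃d₁ , ≃-trans (∷-≃ s tsd≃d₁) e₁
    where
    s = suc j
    t = suc (suc j)
    desc-d₁ : ∀ {d₁} → s ∷ d₁ ≃ a → Descent d₁ (suc j)
    desc-d₁ e₁ = subst₂ _<_
      (sym (trans (∷-≃-evalInv e₁ _) (cong (evalInv a) (swapAt-above j t ≤-refl))))
      (sym (trans (∷-≃-evalInv e₁ _) (cong (evalInv a) (swapAt-right j))))
      (<-trans desc-t desc-s)
    desc-d₂ : ∀ {d₁ d₂} → s ∷ d₁ ≃ a → t ∷ d₂ ≃ d₁ → Descent d₂ j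
    desc-d₂ e₁ e₂ = subst₂ _<_
      (sym (trans (∷-≃-evalInv e₂ _) (trans (∷-≃-evalInv e₁ _)
        (cong (evalInv a) (trans (cong (swapAt s) (swapAt-left (suc j))) (swapAt-above j t ≤-refl))))))
      (sym (trans (∷-≃-evalInv e₂ _) (trans (∷-≃-evalInv e₁ _)
        (cong (evalInv a) (trans (cong (swapAt s) (swapAt-below (suc j) j (n<1+n j))) (swapAt-left j))))))
      desc-t

  -- Minimal words s ∷ a′ and t ∷ b′ with s ≠ t are joined through minimal words starting with s t s and
  -- t s t (or s t and t s when s and t commute), which differ by a single move; the tails are handled by
  -- induction on the length.
  module Induction-step (k : ℕ)
    (ih : ∀ {a b} → length a ≡ k → Minimal a → Minimal b → a ≃ b → Star Move a b) where

    through-move : ∀ {i j a′ b′ c c′} → length a′ ≡ k → Minimal (i ∷ a′) → Minimal (j ∷ b′) →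
      i ∷ a′ ≃ j ∷ b′ → Minimal (i ∷ c) → i ∷ c ≃ i ∷ a′ → Move (i ∷ c) (j ∷ c′) → Star Move (i ∷ a′) (j ∷ b′)
    through-move {i} {j} |a′| ma mb a≃b mc c≃a move =
      Moves-∷ i (ih |a′| (Minimal-tail ma) (Minimal-tail mc) (∷-cancel-≃ i (≃-sym c≃a))) ◅◅
      move ◅ Moves-∷ j (ih |c′| (Minimal-tail mc′) (Minimal-tail mb) (∷-cancel-≃ j c′≃b))
      where
      mc′ = Move-Minimal mc move
      c′≃b = ≃-trans (≃-sym (Move-≃ (proj₁ mc) move)) (≃-trans c≃a a≃b)
      |c′| = suc-injective (trans (sym (Move-length move)) (trans (Minimal-≃-length mc ma c≃a) (cong suc |a′|)))

    far-heads : ∀ {js jt a′ b′} → suc js < jt → length a′ ≡ k →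
      Minimal (suc js ∷ a′) → Minimal (suc jt ∷ b′) →
      suc js ∷ a′ ≃ suc jt ∷ b′ → Star Move (suc js ∷ a′) (suc jt ∷ b′)
    far-heads {js} {jt} far |a′| ma mb a≃b =
      let d , m , e = comm-prefix (proj₁ ma) far (Minimal-head mb)
                        (proj₂ (Minimal-∷⁻ ma)) (Descent-≃ a≃b (proj₂ (Minimal-∷⁻ mb)))
      in through-move |a′| ma mb a≃b m e (inj₂ (comm [] d (suc js) (suc jt) (inj₁ (s≤s far))))

    adjacent-heads : ∀ {j a′ b′} → length a′ ≡ k → Minimal (suc j ∷ a′) → Minimal (suc (suc j) ∷ b′) →
      suc j ∷ a′ ≃ suc (suc j) ∷ b′ → Star Move (suc j ∷ a′) (suc (suc j) ∷ b′)
    adjacent-heads {j} |a′| ma mb a≃b =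
      let d , m , e = braid-prefix (proj₁ ma) (Minimal-head mb)
                        (proj₂ (Minimal-∷⁻ ma)) (Descent-≃ a≃b (proj₂ (Minimal-∷⁻ mb)))
      in through-move |a′| ma mb a≃b m e (inj₁ (braid-up [] d (suc j)))

    distinct-heads : ∀ {js jt a′ b′} → js < jt → length a′ ≡ k →
      Minimal (suc js ∷ a′) → Minimal (suc jt ∷ b′) →
      suc js ∷ a′ ≃ suc jt ∷ b′ → Star Move (suc js ∷ a′) (suc jt ∷ b′)
    distinct-heads js<jt with m≤n⇒m<n∨m≡n js<jt
    ... | inj₁ far  = far-heads far
    ... | inj₂ refl = adjacent-heads

    connect-∷ : ∀ {i j a′ b′} → length a′ ≡ k → Minimal (i ∷ a′) → Minimal (j ∷ b′) →
      i ∷ a′ ≃ j ∷ b′ → Star Move (i ∷ a′) (j ∷ b′)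
    connect-∷ {zero} _ ((() , _) ∷ _ , _)
    connect-∷ {suc _} {zero} _ _ ((() , _) ∷ _ , _)
    connect-∷ {suc js} {suc jt} |a′| ma mb a≃b with <-cmp js jt
    ... | tri≈ _ refl _ = Moves-∷ (suc js) (ih |a′| (Minimal-tail ma) (Minimal-tail mb) (∷-cancel-≃ (suc js) a≃b))
    ... | tri< js<jt _ _ = distinct-heads js<jt |a′| ma mb a≃b
    ... | tri> _ _ jt<js = reverse Move-sym (distinct-heads jt<js |b′| mb ma (≃-sym a≃b))
      where
      |b′| = suc-injective (trans (sym (Minimal-≃-length ma mb a≃b)) (cong suc |a′|))

  matsumoto : ∀ {a b} → Minimal a → Minimal b → a ≃ b → Star Move a b
  matsumoto {a} = connect (length a) refl
    where
    connect : ∀ k {a b} → length a ≡ k → Minimal a → Minimal b → a ≃ b → Star Move a b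
    connect _       {[]}    {[]}    _ _  _  _   = ε
    connect _       {[]}    {_ ∷ _} _ ma mb a≃b = ⊥-elim (0≢1+n (Minimal-≃-length ma mb a≃b))
    connect _       {_ ∷ _} {[]}    _ ma mb a≃b = ⊥-elim (1+n≢0 (Minimal-≃-length ma mb a≃b))
    connect (suc k) {_ ∷ _} {_ ∷ _} |a| = Induction-step.connect-∷ k (connect k) (suc-injective |a|)

-- A braid class meets a commutation class in at most one word

module Restriction {A : Set} (_≟ᴬ_ : DecidableEquality A) where

  InPair : A → A → A → Set
  InPair P Q X = X ≡ P ⊎ X ≡ Q

  inPair? : ∀ P Q X → Dec (InPair P Q X)
  inPair? P Q X = (X ≟ᴬ P) ⊎-dec (X ≟ᴬ Q)

  restrict : A → A → List A → List A
  restrict P Q = filter (inPair? P Q)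

  restrict-∷ : ∀ P Q X {xs ys} → restrict P Q xs ≡ restrict P Q ys → restrict P Q (X ∷ xs) ≡ restrict P Q (X ∷ ys)
  restrict-∷ P Q X eq with inPair? P Q X
  ... | yes X∈ = trans (filter-accept (inPair? P Q) X∈) (trans (cong (X ∷_) eq) (sym (filter-accept (inPair? P Q) X∈)))
  ... | no X∉  = trans (filter-reject (inPair? P Q) X∉) (trans eq (sym (filter-reject (inPair? P Q) X∉)))

  restrict-swap : ∀ P Q {X Y} zs → ¬ (InPair P Q X × InPair P Q Y) →
    restrict P Q (X ∷ Y ∷ zs) ≡ restrict P Q (Y ∷ X ∷ zs)
  restrict-swap P Q {X} {Y} zs not-both with inPair? P Q X | inPair? P Q Y
  ... | yes X∈ | yes Y∈ = ⊥-elim (not-both (X∈ , Y∈))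
  ... | yes X∈ | no Y∉  = begin
    restrict P Q (X ∷ Y ∷ zs)  ≡⟨ filter-accept (inPair? P Q) X∈ ⟩
    X ∷ restrict P Q (Y ∷ zs)  ≡⟨ cong (X ∷_) (filter-reject (inPair? P Q) Y∉) ⟩
    X ∷ restrict P Q zs        ≡⟨ filter-accept (inPair? P Q) X∈ ⟨
    restrict P Q (X ∷ zs)      ≡⟨ filter-reject (inPair? P Q) Y∉ ⟨
    restrict P Q (Y ∷ X ∷ zs)  ∎
  ... | no X∉  | yes Y∈ = begin
    restrict P Q (X ∷ Y ∷ zs)  ≡⟨ filter-reject (inPair? P Q) X∉ ⟩
    restrict P Q (Y ∷ zs)      ≡⟨ filter-accept (inPair? P Q) Y∈ ⟩
    Y ∷ restrict P Q zs        ≡⟨ cong (Y ∷_) (filter-reject (inPair? P Q) X∉) ⟨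
    Y ∷ restrict P Q (X ∷ zs)  ≡⟨ filter-accept (inPair? P Q) Y∈ ⟨
    restrict P Q (Y ∷ X ∷ zs)  ∎
  ... | no X∉  | no Y∉  = begin
    restrict P Q (X ∷ Y ∷ zs)  ≡⟨ filter-reject (inPair? P Q) X∉ ⟩
    restrict P Q (Y ∷ zs)      ≡⟨ filter-reject (inPair? P Q) Y∉ ⟩
    restrict P Q zs            ≡⟨ filter-reject (inPair? P Q) X∉ ⟨
    restrict P Q (X ∷ zs)      ≡⟨ filter-reject (inPair? P Q) Y∉ ⟨
    restrict P Q (Y ∷ X ∷ zs)  ∎

  restrict-injective : ∀ {xs ys} → (∀ P Q → restrict P Q xs ≡ restrict P Q ys) → xs ≡ ys
  restrict-injective {[]} {[]} _ = refl
  restrict-injective {[]} {y ∷ ys} h with () ← trans (h y y) (filter-accept (inPair? y y) (inj₁ refl))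
  restrict-injective {x ∷ xs} {[]} h with () ← trans (sym (filter-accept (inPair? x x) (inj₁ refl))) (h x x)
  restrict-injective {x ∷ xs} {y ∷ ys} h
    with refl , _ ← ∷-injective (trans (sym (filter-accept (inPair? x y) (inj₁ refl)))
                                  (trans (h x y) (filter-accept (inPair? x y) (inj₂ refl))))
    = cong (x ∷_) (restrict-injective tails)
    where
    tails : ∀ P Q → restrict P Q xs ≡ restrict P Q ys
    tails P Q with inPair? P Q x
    ... | yes x∈ = proj₂ (∷-injective (trans (sym (filter-accept (inPair? P Q) x∈))
                                        (trans (h P Q) (filter-accept (inPair? P Q) x∈))))
    ... | no x∉  = trans (sym (filter-reject (inPair? P Q) x∉)) (trans (h P Q) (filter-reject (inPair? P Q) x∉))

-- Each letter contributes the pair of values it transposes in the one-line notation of the suffix after it.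
inversionSeq : Word → List (ℕ × ℕ)
inversionSeq []      = []
inversionSeq (i ∷ a) = (evalInv a (pred i) , evalInv a i) ∷ inversionSeq a

inversionSeq-++ : ∀ p q → inversionSeq (p ++ q) ≡ map (Product.map (evalInv q) (evalInv q)) (inversionSeq p) ++ inversionSeq q
inversionSeq-++ []      q = refl
inversionSeq-++ (i ∷ p) q = cong₂ _∷_ (cong₂ _,_ (evalInv-++ p q (pred i)) (evalInv-++ p q i)) (inversionSeq-++ p q)

inversionSeq-injective : ∀ {a b} → inversionSeq a ≡ inversionSeq b → a ≡ b
inversionSeq-injective {[]}    {[]}    _ = refl
inversionSeq-injective {i ∷ a} {j ∷ b} eq with ∷-injective eq
... | heads , tails with refl ← inversionSeq-injective tails =
  cong (_∷ a) (evalInv-injective a (proj₂ (Product.,-injective heads)))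

Overlap : ℕ × ℕ → ℕ × ℕ → Set
Overlap (x , y) (x′ , y′) = x ≡ x′ ⊎ x ≡ y′ ⊎ y ≡ x′ ⊎ y ≡ y′

overlap? : ∀ X Y → Dec (Overlap X Y)
overlap? (x , y) (x′ , y′) = (x ≟ x′) ⊎-dec (x ≟ y′) ⊎-dec (y ≟ x′) ⊎-dec (y ≟ y′)

Overlap-sym : ∀ {X Y} → Overlap X Y → Overlap Y X
Overlap-sym (inj₁ e)                = inj₁ (sym e)
Overlap-sym (inj₂ (inj₁ e))         = inj₂ (inj₂ (inj₁ (sym e)))
Overlap-sym (inj₂ (inj₂ (inj₁ e)))  = inj₂ (inj₁ (sym e))
Overlap-sym (inj₂ (inj₂ (inj₂ e)))  = inj₂ (inj₂ (inj₂ (sym e)))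

open Restriction (Product.≡-dec _≟_ _≟_)

overlapping-not-both : ∀ {P Q X Y} → Overlap P Q → ¬ Overlap X Y → ¬ (InPair P Q X × InPair P Q Y)
overlapping-not-both PQ ¬XY (inj₁ refl , inj₁ refl) = ¬XY (inj₁ refl)
overlapping-not-both PQ ¬XY (inj₁ refl , inj₂ refl) = ¬XY PQ
overlapping-not-both PQ ¬XY (inj₂ refl , inj₁ refl) = ¬XY (Overlap-sym PQ)
overlapping-not-both PQ ¬XY (inj₂ refl , inj₂ refl) = ¬XY (inj₁ refl)

disjoint-not-both : ∀ {P Q X Y} → ¬ Overlap P Q → X ≢ Y → Overlap X Y → ¬ (InPair P Q X × InPair P Q Y)
disjoint-not-both ¬PQ X≢Y XY (inj₁ refl , inj₁ refl) = X≢Y refl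
disjoint-not-both ¬PQ X≢Y XY (inj₁ refl , inj₂ refl) = ¬PQ XY
disjoint-not-both ¬PQ X≢Y XY (inj₂ refl , inj₁ refl) = ¬PQ (Overlap-sym XY)
disjoint-not-both ¬PQ X≢Y XY (inj₂ refl , inj₂ refl) = X≢Y refl

far-no-overlap : ∀ (g : ℕ → ℕ) → (∀ {x y} → g x ≡ g y → x ≡ y) →
  ∀ {i j} → Far i j → ¬ Overlap (g (pred i) , g i) (g (pred j) , g j)
far-no-overlap g g-inj (inj₁ i+1<j) = below i+1<j
  where
  below : ∀ {i j} → suc i < j → ¬ Overlap (g (pred i) , g i) (g (pred j) , g j)
  below {i} (s≤s i<b) (inj₁ e)                = <⇒≢ (≤-<-trans pred[n]≤n i<b) (g-inj e)
  below {i} (s≤s i<b) (inj₂ (inj₁ e))         = <⇒≢ (≤-<-trans pred[n]≤n (m<n⇒m<1+n i<b)) (g-inj e)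
  below     (s≤s i<b) (inj₂ (inj₂ (inj₁ e)))  = <⇒≢ i<b (g-inj e)
  below     (s≤s i<b) (inj₂ (inj₂ (inj₂ e)))  = <⇒≢ (m<n⇒m<1+n i<b) (g-inj e)
far-no-overlap g g-inj (inj₂ j+1<i) = far-no-overlap g g-inj (inj₁ j+1<i) ∘ Overlap-sym

swapAt-far : ∀ {i j} → Far i j → swapAt j (pred i) ≡ pred i × swapAt j i ≡ i
swapAt-far {i}     {zero}  _ = refl , refl
swapAt-far {i}     {suc b} (inj₁ (s≤s i<b)) = swapAt-below b (pred i) (≤-<-trans pred[n]≤n i<b) , swapAt-below b i i<b
swapAt-far {suc i} {suc b} (inj₂ (s≤s b+1<i)) = swapAt-above b i b+1<i , swapAt-above b (suc i) (m<n⇒m<1+n b+1<i)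

comm-inversionSeq : ∀ {i j} q → Far i j →
  inversionSeq (i ∷ j ∷ q) ≡ (evalInv q (pred i) , evalInv q i) ∷ (evalInv q (pred j) , evalInv q j) ∷ inversionSeq q
comm-inversionSeq q far =
  cong (_∷ _) (cong₂ _,_ (cong (evalInv q) (proj₁ (swapAt-far far))) (cong (evalInv q) (proj₂ (swapAt-far far))))

module _ (a : ℕ) (q : Word) where
  private
    g = evalInv q
    s = swapAt (suc a)
    t = swapAt (suc (suc a))

  braid-inversionSeqˡ : inversionSeq (suc a ∷ suc (suc a) ∷ suc a ∷ q) ≡
    (g (suc a) , g (suc (suc a))) ∷ (g a , g (suc (suc a))) ∷ (g a , g (suc a)) ∷ inversionSeq q
  braid-inversionSeqˡ = cong₂ _∷_
    (cong₂ _,_ (cong g (trans (cong s (swapAt-below (suc a) a (n<1+n a))) (swapAt-left a)))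
               (cong g (trans (cong s (swapAt-left (suc a))) (swapAt-above a (suc (suc a)) ≤-refl))))
    (cong₂ _∷_ (cong₂ _,_ (cong g (swapAt-right a)) (cong g (swapAt-above a (suc (suc a)) ≤-refl))) refl)

  braid-inversionSeqʳ : inversionSeq (suc (suc a) ∷ suc a ∷ suc (suc a) ∷ q) ≡
    (g a , g (suc a)) ∷ (g a , g (suc (suc a))) ∷ (g (suc a) , g (suc (suc a))) ∷ inversionSeq q
  braid-inversionSeqʳ = cong₂ _∷_
    (cong₂ _,_ (cong g (trans (cong t (swapAt-right a)) (swapAt-below (suc a) a (n<1+n a))))
               (cong g (trans (cong t (swapAt-above a (suc (suc a)) ≤-refl)) (swapAt-right (suc a)))))
    (cong₂ _∷_ (cong₂ _,_ (cong g (swapAt-below (suc a) a (n<1+n a))) (cong g (swapAt-left (suc a)))) refl)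

restrict-inversionSeq-++ : ∀ P Q p {x y} → x ≃ y →
  restrict P Q (inversionSeq x) ≡ restrict P Q (inversionSeq y) →
  restrict P Q (inversionSeq (p ++ x)) ≡ restrict P Q (inversionSeq (p ++ y))
restrict-inversionSeq-++ P Q p {x} {y} x≃y eq = begin
  restrict P Q (inversionSeq (p ++ x))
    ≡⟨ cong (restrict P Q) (inversionSeq-++ p x) ⟩
  restrict P Q (map (both x) (inversionSeq p) ++ inversionSeq x)
    ≡⟨ filter-++ (inPair? P Q) (map (both x) (inversionSeq p)) _ ⟩
  restrict P Q (map (both x) (inversionSeq p)) ++ restrict P Q (inversionSeq x)
    ≡⟨ cong₂ (λ zs ws → restrict P Q zs ++ ws)
         (map-cong (λ _ → cong₂ _,_ (evalInv-≗ x≃y _) (evalInv-≗ x≃y _)) (inversionSeq p)) eq ⟩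
  restrict P Q (map (both y) (inversionSeq p)) ++ restrict P Q (inversionSeq y)
    ≡⟨ filter-++ (inPair? P Q) (map (both y) (inversionSeq p)) _ ⟨
  restrict P Q (map (both y) (inversionSeq p) ++ inversionSeq y)
    ≡⟨ cong (restrict P Q) (inversionSeq-++ p y) ⟨
  restrict P Q (inversionSeq (p ++ y)) ∎
  where
  both : Word → ℕ × ℕ → ℕ × ℕ
  both z = Product.map (evalInv z) (evalInv z)

CommStep-restrict : ∀ {u v} → CommStep u v → ∀ {P Q} → Overlap P Q →
  restrict P Q (inversionSeq u) ≡ restrict P Q (inversionSeq v)
CommStep-restrict (comm p q i j far) {P} {Q} PQ = restrict-inversionSeq-++ P Q p (comm-≃ q far) (begin
  restrict P Q (inversionSeq (i ∷ j ∷ q))       ≡⟨ cong (restrict P Q) (comm-inversionSeq q far) ⟩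
  restrict P Q (X ∷ Y ∷ inversionSeq q)
    ≡⟨ restrict-swap P Q _ (overlapping-not-both PQ (far-no-overlap g (evalInv-injective q) far)) ⟩
  restrict P Q (Y ∷ X ∷ inversionSeq q)         ≡⟨ cong (restrict P Q) (comm-inversionSeq q (Far-sym far)) ⟨
  restrict P Q (inversionSeq (j ∷ i ∷ q))       ∎)
  where
  g = evalInv q
  X = (g (pred i) , g i)
  Y = (g (pred j) , g j)

braid-restrict : ∀ a q {P Q} → ¬ Overlap P Q →
  restrict P Q (inversionSeq (suc a ∷ suc (suc a) ∷ suc a ∷ q)) ≡
  restrict P Q (inversionSeq (suc (suc a) ∷ suc a ∷ suc (suc a) ∷ q))
braid-restrict a q {P} {Q} ¬PQ = begin
  restrict P Q (inversionSeq (suc a ∷ suc (suc a) ∷ suc a ∷ q))  ≡⟨ cong (restrict P Q) (braid-inversionSeqˡ a q) ⟩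
  restrict P Q (X ∷ Y ∷ Z ∷ rest)  ≡⟨ restrict-swap P Q _ (disjoint-not-both ¬PQ X≢Y (inj₂ (inj₂ (inj₂ refl)))) ⟩
  restrict P Q (Y ∷ X ∷ Z ∷ rest)
    ≡⟨ restrict-∷ P Q Y (restrict-swap P Q _ (disjoint-not-both ¬PQ X≢Z (inj₂ (inj₁ refl)))) ⟩
  restrict P Q (Y ∷ Z ∷ X ∷ rest)  ≡⟨ restrict-swap P Q _ (disjoint-not-both ¬PQ Y≢Z (inj₁ refl)) ⟩
  restrict P Q (Z ∷ Y ∷ X ∷ rest)  ≡⟨ cong (restrict P Q) (braid-inversionSeqʳ a q) ⟨
  restrict P Q (inversionSeq (suc (suc a) ∷ suc a ∷ suc (suc a) ∷ q)) ∎
  where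
  g = evalInv q
  rest = inversionSeq q
  X = (g (suc a) , g (suc (suc a)))
  Y = (g a , g (suc (suc a)))
  Z = (g a , g (suc a))
  a≢ : ∀ {x y} → x < y → g x ≢ g y
  a≢ x<y = <⇒≢ x<y ∘ evalInv-injective q
  X≢Y : X ≢ Y
  X≢Y e = a≢ (n<1+n a) (sym (proj₁ (Product.,-injective e)))
  X≢Z : X ≢ Z
  X≢Z e = a≢ (n<1+n (suc a)) (sym (proj₂ (Product.,-injective e)))
  Y≢Z : Y ≢ Z
  Y≢Z e = a≢ (n<1+n (suc a)) (sym (proj₂ (Product.,-injective e)))

BraidStep-restrict : ∀ {n u v} → ValidWord n u → BraidStep u v → ∀ {P Q} → ¬ Overlap P Q →
  restrict P Q (inversionSeq u) ≡ restrict P Q (inversionSeq v)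
BraidStep-restrict vu (braid-up p q i) ¬PQ with All.++⁻ p vu
BraidStep-restrict vu (braid-up p q zero) ¬PQ | _ , (() , _) ∷ _
BraidStep-restrict vu (braid-up p q (suc a)) {P} {Q} ¬PQ | _ =
  restrict-inversionSeq-++ P Q p (braid-≃ a q) (braid-restrict a q ¬PQ)
BraidStep-restrict vu (braid-down p q i) ¬PQ with All.++⁻ p vu
BraidStep-restrict vu (braid-down p q zero) ¬PQ | _ , _ ∷ (() , _) ∷ _
BraidStep-restrict vu (braid-down p q (suc a)) {P} {Q} ¬PQ | _ =
  restrict-inversionSeq-++ P Q p (≃-sym (braid-≃ a q)) (sym (braid-restrict a q ¬PQ))

CommEquiv-restrict : ∀ {u v} → CommEquiv u v → ∀ {P Q} → Overlap P Q →
  restrict P Q (inversionSeq u) ≡ restrict P Q (inversionSeq v)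
CommEquiv-restrict ε           PQ = refl
CommEquiv-restrict (step ◅ cs) PQ = trans (CommStep-restrict step PQ) (CommEquiv-restrict cs PQ)

BraidEquiv-restrict : ∀ {n u v} → ValidWord n u → BraidEquiv u v → ∀ {P Q} → ¬ Overlap P Q →
  restrict P Q (inversionSeq u) ≡ restrict P Q (inversionSeq v)
BraidEquiv-restrict vu ε            ¬PQ = refl
BraidEquiv-restrict vu (step ◅ bs) ¬PQ =
  trans (BraidStep-restrict vu step ¬PQ) (BraidEquiv-restrict (Move-valid vu (inj₁ step)) bs ¬PQ)

braid∩comm : ∀ {n a b} → ValidWord n a → BraidEquiv a b → CommEquiv a b → a ≡ b
braid∩comm va a~b a≈b = inversionSeq-injective (restrict-injective λ P Q → case overlap? P Q of λ where
  (yes PQ)  → CommEquiv-restrict a≈b PQ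
  (no ¬PQ) → BraidEquiv-restrict va a~b ¬PQ)

-- Counting

∈-++-∷⁻ : ∀ {A : Set} (ys₁ : List A) {y ys₂ z} → z ∈ ys₁ ++ y ∷ ys₂ → z ≡ y ⊎ z ∈ ys₁ ++ ys₂
∈-++-∷⁻ ys₁ z∈ with ∈-++⁻ ys₁ z∈
... | inj₁ z∈ys₁         = inj₂ (∈-++⁺ˡ z∈ys₁)
... | inj₂ (here z≡y)    = inj₁ z≡y
... | inj₂ (there z∈ys₂) = inj₂ (∈-++⁺ʳ ys₁ z∈ys₂)

length-≤-injective-relation : ∀ {A B : Set} (R : A → B → Set) {xs : List A} {ys : List B} → Unique xs →
  (∀ {x} → x ∈ xs → ∃ λ y → y ∈ ys × R x y) →
  (∀ {x x′ y} → x ∈ xs → x′ ∈ xs → R x y → R x′ y → x ≡ x′) →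
  length xs ≤ length ys
length-≤-injective-relation R {[]}     _             _     _   = z≤n
length-≤-injective-relation R {x ∷ xs} (x∉xs ∷ uniq) total inj with total (here refl)
... | y , y∈ys , xRy with ys₁ , ys₂ , refl ← ∈-∃++ y∈ys =
  ≤-trans (s≤s (length-≤-injective-relation R uniq total′ (λ p p′ → inj (there p) (there p′))))
          (≤-reflexive (sym (length-++-sucʳ ys₁ y ys₂)))
  where
  total′ : ∀ {x′} → x′ ∈ xs → ∃ λ y′ → y′ ∈ ys₁ ++ ys₂ × R x′ y′
  total′ x′∈ with total (there x′∈)
  ... | y′ , y′∈ , x′Ry′ with ∈-++-∷⁻ ys₁ y′∈
  ...   | inj₂ y′∈′ = y′ , y′∈′ , x′Ry′
  ...   | inj₁ refl = ⊥-elim (All.lookup x∉xs x′∈ (inj (here refl) (there x′∈) xRy x′Ry′))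

length-cartesianProduct : ∀ {A B : Set} (xs : List A) (ys : List B) →
  length (cartesianProduct xs ys) ≡ length xs * length ys
length-cartesianProduct []       ys = refl
length-cartesianProduct (x ∷ xs) ys = begin
  length (map (x ,_) ys ++ cartesianProduct xs ys)        ≡⟨ length-++ (map (x ,_) ys) ⟩
  length (map (x ,_) ys) + length (cartesianProduct xs ys)
    ≡⟨ cong₂ _+_ (length-map (x ,_) ys) (length-cartesianProduct xs ys) ⟩
  length ys + length xs * length ys                      ∎

∈-mapWith∈ : ∀ {A B : Set} {xs : List A} (f : ∀ {x} → x ∈ xs → B) {x} (x∈ : x ∈ xs) → f x∈ ∈ mapWith∈ xs f
∈-mapWith∈ f (here refl) = here refl
∈-mapWith∈ f (there x∈)  = there (∈-mapWith∈ (f ∘ there) x∈)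

module Graph {V : Set} (_≟ⱽ_ : DecidableEquality V) (edges : List (V × V)) where
  open import Data.List.Membership.DecPropositional _≟ⱽ_ using (_∈?_)

  Adjacent : V → V → Set
  Adjacent u v = (u , v) ∈ edges ⊎ (v , u) ∈ edges

  Adjacent-sym : ∀ {u v} → Adjacent u v → Adjacent v u
  Adjacent-sym (inj₁ e) = inj₂ e
  Adjacent-sym (inj₂ e) = inj₁ e

  crossing : ∀ S {u v} → u ∈ S → ¬ v ∈ S → Star Adjacent u v → ∃₂ λ x y → x ∈ S × ¬ y ∈ S × Adjacent x y
  crossing S u∈S v∉S ε = ⊥-elim (v∉S u∈S)
  crossing S {u} u∈S v∉S (_◅_ {j = w} u-w w⇝v) with w ∈? S
  ... | yes w∈S = crossing S w∈S v∉S w⇝v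
  ... | no w∉S  = u , w , u∈S , w∉S , u-w

  Spanned : List V → List (V × V) → Set
  Spanned S unused = ∀ {x y} → (x , y) ∈ edges → (x , y) ∈ unused ⊎ (x ∈ S × y ∈ S)

  use-edge : ∀ {S unused x y v} → Spanned S unused → (x , y) ∈ unused → x ∈ v ∷ S → y ∈ v ∷ S →
    ∃ λ unused′ → length unused ≡ suc (length unused′) × Spanned (v ∷ S) unused′
  use-edge {S} {x = x} {y} spanned xy∈ x∈ y∈ with U₁ , U₂ , refl ← ∈-∃++ xy∈ =
    U₁ ++ U₂ , length-++-sucʳ U₁ (x , y) U₂ , spanned′
    where
    spanned′ : Spanned (_ ∷ S) (U₁ ++ U₂)
    spanned′ e∈ with spanned e∈
    ... | inj₂ (x′∈ , y′∈) = inj₂ (there x′∈ , there y′∈)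
    ... | inj₁ e∈U with ∈-++-∷⁻ U₁ e∈U
    ...   | inj₁ refl = inj₂ (x∈ , y∈)
    ...   | inj₂ e∈U′ = inj₁ e∈U′

  Spanned-unused : ∀ {S unused a b} → Spanned S unused → (a , b) ∈ edges → ¬ (a ∈ S × b ∈ S) → (a , b) ∈ unused
  Spanned-unused spanned ab∈ not-both with spanned ab∈
  ... | inj₁ ab∈U = ab∈U
  ... | inj₂ both = ⊥-elim (not-both both)

  -- Grow a vertex set S from one vertex, each time adding the far end of an unused edge leaving S;
  -- connectivity supplies such an edge as long as S misses a vertex.
  module Growth {vertices : List V} (unique : Unique vertices)
                (connected : ∀ {u v} → u ∈ vertices → v ∈ vertices → Star Adjacent u v) where

    extend : ∀ {S unused u₀} → Spanned S unused → u₀ ∈ vertices → u₀ ∈ S → ¬ All (_∈ S) vertices →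
      ∃₂ λ y unused′ → length unused ≡ suc (length unused′) × Spanned (y ∷ S) unused′
    extend {S} spanned u₀∈V u₀∈S ¬all∈S
      with v , v∈V , v∉S ← find (All.¬All⇒Any¬ (_∈? S) vertices ¬all∈S)
      with x , y , x∈S , y∉S , x-y ← crossing S u₀∈S v∉S (connected u₀∈V v∈V)
      with x-y
    ... | inj₁ xy∈ = y , use-edge spanned (Spanned-unused spanned xy∈ (y∉S ∘ proj₂)) (there x∈S) (here refl)
    ... | inj₂ yx∈ = y , use-edge spanned (Spanned-unused spanned yx∈ (y∉S ∘ proj₁)) (here refl) (there x∈S)

    grow : ∀ k {S unused u₀} → length unused ≡ k → u₀ ∈ vertices → u₀ ∈ S → Spanned S unused →
      length S + length unused ≤ suc (length edges) → length vertices ≤ suc (length edges)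
    grow k {S} |U| u₀∈V u₀∈S spanned bound with All.all? (_∈? S) vertices
    ... | yes all∈S = ≤-trans (length-≤-injective-relation _≡_ unique (λ {v} v∈ → v , All.lookup all∈S v∈ , refl)
                                  (λ _ _ e e′ → trans e (sym e′)))
                              (≤-trans (m≤m+n _ _) bound)
    ... | no ¬all∈S with extend spanned u₀∈V u₀∈S ¬all∈S | k
    ...   | _ , _ , |U|≡ , _ | zero  = ⊥-elim (1+n≢0 (trans (sym |U|≡) |U|))
    ...   | _ , U′ , |U|≡ , spanned′ | suc k =
      grow k (suc-injective (trans (sym |U|≡) |U|)) u₀∈V (there u₀∈S) spanned′
        (≤-trans (≤-reflexive (trans (sym (+-suc (length S) (length U′))) (cong (length S +_) (sym |U|≡)))) bound)

  connected⇒length-≤ : ∀ {vertices} → Unique vertices →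
    (∀ {u v} → u ∈ vertices → v ∈ vertices → Star Adjacent u v) → length vertices ≤ suc (length edges)
  connected⇒length-≤ {[]}    _      _         = z≤n
  connected⇒length-≤ {v ∷ _} unique connected =
    Growth.grow unique connected (length edges) {v ∷ []} refl (here refl) (here refl) inj₁ ≤-refl

module _ {_~_ : Word → Word → Set} {P : Word → Set} {reps : List Word} (reps-ok : IsClassReps _~_ P reps) where

  class-rep : ∀ {u} → P u → ∃ λ r → r ∈ reps × u ~ r
  class-rep pu = find (proj₁ (proj₂ reps-ok) _ pu)

  class-rep-≡ : (∀ {u v} → u ~ v → v ~ u) → ∀ {r s} → r ∈ reps → s ∈ reps → r ~ s → r ≡ s
  class-rep-≡ ~-sym = go (proj₂ (proj₂ reps-ok))
    where
    go : ∀ {rs} → AllPairs (λ r s → ¬ (r ~ s)) rs → ∀ {r s} → r ∈ rs → s ∈ rs → r ~ s → r ≡ s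
    go (_ ∷ _)     (here refl) (here refl) _   = refl
    go (r≁ ∷ _)    (here refl) (there s∈)  r~s = ⊥-elim (All.lookup r≁ s∈ r~s)
    go (s≁ ∷ _)    (there r∈)  (here refl) r~s = ⊥-elim (All.lookup s≁ r∈ (~-sym r~s))
    go (_ ∷ apart) (there r∈)  (there s∈)  r~s = go apart r∈ s∈ r~s

  class-reps-unique : (∀ {u} → u ~ u) → Unique reps
  class-reps-unique ~-refl = AllPairs.map (λ r≁s r≡s → r≁s (subst (_ ~_) r≡s ~-refl)) (proj₂ (proj₂ reps-ok))

-- The two inequalities

module Bounds {n : ℕ} (w : Permutation′ n) {R B C : List Word}
  (enum-R : IsEnumeration (Reduced w) R)
  (reps-B : IsClassReps BraidEquiv (Reduced w) B)
  (reps-C : IsClassReps CommEquiv (Reduced w) C) where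

  open Length n using (Reduced⇒Minimal; Reduced⇒≃)
  open Matsumoto n using (matsumoto)

  reduced : ∀ {u} → u ∈ R → Reduced w u
  reduced = proj₁ (proj₂ enum-R) _

  listed : ∀ {u} → Reduced w u → u ∈ R
  listed = proj₂ (proj₂ enum-R) _

  braid-rep = class-rep reps-B
  comm-rep  = class-rep reps-C

  braid-rep-≡ : ∀ {r s} → r ∈ B → s ∈ B → BraidEquiv r s → r ≡ s
  braid-rep-≡ = class-rep-≡ reps-B BraidEquiv-sym

  comm-rep-≡ : ∀ {r s} → r ∈ C → s ∈ C → CommEquiv r s → r ≡ s
  comm-rep-≡ = class-rep-≡ reps-C CommEquiv-sym

  upper-bound : length R ≤ length B * length C
  upper-bound = ≤-trans (length-≤-injective-relation InClasses (proj₁ enum-R) classes same-word)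
                        (≤-reflexive (length-cartesianProduct B C))
    where
    InClasses : Word → Word × Word → Set
    InClasses u (b , c) = BraidEquiv u b × CommEquiv u c
    classes : ∀ {u} → u ∈ R → ∃ λ bc → bc ∈ cartesianProduct B C × InClasses u bc
    classes u∈ with b , b∈ , u~b ← braid-rep (reduced u∈) | c , c∈ , u≈c ← comm-rep (reduced u∈) =
      (b , c) , ∈-cartesianProduct⁺ b∈ c∈ , u~b , u≈c
    same-word : ∀ {u u′ bc} → u ∈ R → u′ ∈ R → InClasses u bc → InClasses u′ bc → u ≡ u′
    same-word u∈ _ (u~b , u≈c) (u′~b , u′≈c) =
      braid∩comm (proj₁ (reduced u∈)) (u~b ◅◅ BraidEquiv-sym u′~b) (u≈c ◅◅ CommEquiv-sym u′≈c)

  Vertex : Set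
  Vertex = Word ⊎ Word

  vertices : List Vertex
  vertices = map inj₁ B ++ map inj₂ C

  edge : ∀ {u} → u ∈ R → Vertex × Vertex
  edge u∈ = inj₁ (proj₁ (braid-rep (reduced u∈))) , inj₂ (proj₁ (comm-rep (reduced u∈)))

  edges : List (Vertex × Vertex)
  edges = mapWith∈ R edge

  open Graph (Sum.≡-dec (List.≡-dec _≟_) (List.≡-dec _≟_)) edges

  Anchor : Word → Word → Word → Set
  Anchor u b c = b ∈ B × c ∈ C × BraidEquiv u b × CommEquiv u c × (inj₁ b , inj₂ c) ∈ edges

  anchor : ∀ {u} → Reduced w u → ∃₂ (Anchor u)
  anchor ru =
    let u∈ = listed ru
        b , b∈ , u~b = braid-rep (reduced u∈)
        c , c∈ , u≈c = comm-rep (reduced u∈)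
    in b , c , b∈ , c∈ , u~b , u≈c , ∈-mapWith∈ edge u∈

  Move-link : ∀ {u u′ b c b′ c′} → Anchor u b c → Anchor u′ b′ c′ → Move u u′ →
    Star Adjacent (inj₁ b) (inj₁ b′)
  Move-link (b∈ , _ , u~b , _ , _) (b′∈ , _ , u′~b′ , _ , _) (inj₁ step)
    with refl ← braid-rep-≡ b∈ b′∈ (BraidEquiv-sym u~b ◅◅ step ◅ u′~b′) = ε
  Move-link (_ , c∈ , _ , u≈c , bc∈) (_ , c′∈ , _ , u′≈c′ , b′c′∈) (inj₂ step)
    with refl ← comm-rep-≡ c∈ c′∈ (CommEquiv-sym u≈c ◅◅ step ◅ u′≈c′) = inj₁ bc∈ ◅ inj₂ b′c′∈ ◅ ε

  Moves-link : ∀ {u u′ b c b′ c′} → Reduced w u → Anchor u b c → Anchor u′ b′ c′ → Star Move u u′ →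
    Star Adjacent (inj₁ b) (inj₁ b′)
  Moves-link _ (b∈ , _ , u~b , _) (b′∈ , _ , u~b′ , _) ε
    with refl ← braid-rep-≡ b∈ b′∈ (BraidEquiv-sym u~b ◅◅ u~b′) = ε
  Moves-link ru a a′ (move ◅ moves) =
    let ru₁ = Move-Reduced {w = w} ru move
        _ , _ , a₁ = anchor ru₁
    in Move-link a a₁ move ◅◅ Moves-link ru₁ a₁ a′ moves

  vertex-anchor : ∀ {v} → v ∈ vertices →
    ∃ λ u → Reduced w u × ∃₂ λ b c → Anchor u b c × Star Adjacent v (inj₁ b)
  vertex-anchor v∈ with ∈-++⁻ (map inj₁ B) v∈
  ... | inj₁ v∈B with b₀ , b₀∈ , refl ← ∈-map⁻ inj₁ v∈B =
    let rb₀ = All.lookup (proj₁ reps-B) b₀∈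
        b , c , a@(b∈ , _ , b₀~b , _) = anchor rb₀
    in b₀ , rb₀ , b , c , a , subst (λ b′ → Star Adjacent (inj₁ b₀) (inj₁ b′)) (braid-rep-≡ b₀∈ b∈ b₀~b) ε
  ... | inj₂ v∈C with c₀ , c₀∈ , refl ← ∈-map⁻ inj₂ v∈C =
    let rc₀ = All.lookup (proj₁ reps-C) c₀∈
        b , c , a@(_ , c∈ , _ , c₀≈c , bc∈) = anchor rc₀
    in c₀ , rc₀ , b , c , a ,
       inj₂ (subst (λ c′ → (inj₁ b , inj₂ c′) ∈ edges) (sym (comm-rep-≡ c₀∈ c∈ c₀≈c)) bc∈) ◅ ε

  connected : ∀ {v v′} → v ∈ vertices → v′ ∈ vertices → Star Adjacent v v′
  connected v∈ v′∈ =
    let u  , ru  , _ , _ , a  , v⇝  = vertex-anchor v∈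
        u′ , ru′ , _ , _ , a′ , v′⇝ = vertex-anchor v′∈
        u⇝u′ = matsumoto (Reduced⇒Minimal {w = w} ru) (Reduced⇒Minimal {w = w} ru′) (Reduced⇒≃ {w = w} ru ru′)
    in v⇝ ◅◅ Moves-link ru a a′ u⇝u′ ◅◅ reverse Adjacent-sym v′⇝

  lower-bound : length B + length C ≤ length R + 1
  lower-bound = subst₂ _≤_ |vertices| |edges| (connected⇒length-≤ unique-vertices connected)
    where
    |vertices| : length vertices ≡ length B + length C
    |vertices| = trans (length-++ (map inj₁ B)) (cong₂ _+_ (length-map inj₁ B) (length-map inj₂ C))
    |edges| : suc (length edges) ≡ length R + 1
    |edges| = trans (cong suc (length-mapWith∈ (setoid Word) R)) (+-comm 1 (length R))
    unique-vertices : Unique vertices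
    unique-vertices = Unique.++⁺ (Unique.map⁺ Sum.inj₁-injective (class-reps-unique reps-B ε))
                                 (Unique.map⁺ Sum.inj₂-injective (class-reps-unique reps-C ε))
                                 λ (v∈B , v∈C) → case ∈-map⁻ inj₁ v∈B , ∈-map⁻ inj₂ v∈C of λ where
                                   ((_ , _ , refl) , (_ , _ , ()))

theorem4p6 : (n : ℕ) (w : Permutation′ n) (R B C : List Word) →
    IsEnumeration (Reduced w) R →
    IsClassReps BraidEquiv (Reduced w) B →
    IsClassReps CommEquiv (Reduced w) C →
    (length B + length C ≤ length R + 1) × (length R ≤ length B * length C)
theorem4p6 n w R B C enum-R reps-B reps-C = lower-bound , upper-bound
  where open Bounds w enum-R reps-B reps-C
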